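{- For every $i\ge1$ and every $\mathcal{L}_{\mathsf{PV}}$-sentence $\varphi$, if $\mathsf{T}^i_{\mathsf{PV}}\vdash\varphi$ then $\mathsf{U}^i_{\mathsf{PV}}\vdash\varphi$.
   Context: $\mathcal{L}_{\mathsf{PV}}$ is the first-order language with constants $0,1$, equality as the only relation, and a function symbol for every polynomial-time computable function $f:\mathbb{N}^k\to\mathbb{N}$ (numbers in binary); its standard model is $\mathbb{N}$. Bounded quantifiers are $\exists x\le t$, $\forall x\le t$ with $t$ a term not containing $x$. $\Sigma^b_0=\Pi^b_0$ are the quantifier-free formulas; for $i\ge1$, $\Sigma^b_i,\Pi^b_i$ are the smallest classes containing $\Sigma^b_{i-1}\cup\Pi^b_{i-1}$, closed under $\wedge,\vee$, with $\Sigma^b_i$ closed under bounded $\exists$, $\Pi^b_i$ under bounded $\forall$, and negation exchanging them. $\mathsf{T}^i_{\mathsf{PV}}$ is the set of all sentences $\forall\vec y\,\varphi(\vec y)$ with $\varphi\in\Sigma^b_{i-1}$ that are true in $\mathbb{N}$. For $i\ge1$, $\mathcal{L}^i_{\mathsf{PV}}$ extends $\mathcal{L}_{\mathsf{PV}}$ by: for each $(\Pi^b_{i-1}\cup\Sigma^b_{i-1})$-formula $\alpha(\vec z)$ of $\mathcal{L}_{\mathsf{PV}}$, a function symbol $f_\alpha$ interpreted in $\mathbb{N}$ as the characteristic function of $\alpha$ (value $1$ if $\alpha(\vec z)$ holds, $0$ otherwise); and, when $i\ge2$, for each $\Sigma^b_{i-1}$-formula $\beta(\vec x,y)$ and $\mathcal{L}_{\mathsf{PV}}$-term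 $t$, a function symbol $g_{\beta,t}$ interpreted as the smallest $y$ with $\beta(\vec x,y)$ if some $y\le t(\vec x)$ satisfies $\beta(\vec x,y)$, and $0$ otherwise. $\mathsf{U}^i_{\mathsf{PV}}$ is the theory of all universal $\mathcal{L}^i_{\mathsf{PV}}$-sentences true in this standard model. -}

module Defs where

open import Data.Nat using (ℕ; zero; suc; _+_; _*_; _^_; _≤_; _<_; _≤?_; z≤n; s≤s)
open import Data.Nat.Logarithm using (⌈log₂_⌉)
open import Data.Fin using (Fin; zero; suc)
open import Data.Vec using (Vec; []; _∷_; lookup)
open import Data.List using (List; []; _∷_; map)
open import Data.List.Membership.Propositional using (_∈_)
open import Data.List.Relation.Unary.All using (All)
open import Data.Product using (Σ; _×_; _,_)
open import Data.Sum using (_⊎_; inj₁; inj₂)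
open import Data.Empty using (⊥)
open import Data.Unit using (⊤; tt)
open import Data.Bool using (Bool; true; false; if_then_else_)
open import Data.Maybe using (Maybe; just; nothing; fromMaybe)
import Data.Maybe as Maybe
open import Relation.Nullary using (Dec; yes; no; ¬_; does)
open import Relation.Nullary.Decidable using (_×-dec_; _⊎-dec_; _→-dec_; ¬?)
open import Relation.Binary.PropositionalEquality using (_≡_; refl; sym; subst; cong)
import Data.Nat.Properties as NP

-- Polynomial-time computable functions ℕ^k → ℕ, via Cobham's function
-- algebra (closure of basic functions under composition and limited
-- recursion on notation).  Basic functions: zero, s₀ x = 2x, s₁ x = 2x+1,
-- projections, smash x # y = 2^(|x|·|y|), and (for convenience, since it
-- is obviously polynomial-time and does not change the class) the
-- characteristic function of ≤.

len : ℕ → ℕ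
len x = ⌈log₂ (suc x) ⌉

charD : {A : Set} → Dec A → ℕ
charD (yes _) = 1
charD (no _)  = 0

leqF : Vec ℕ 2 → ℕ
leqF (x ∷ y ∷ []) = charD (x ≤? y)

data IsFP : {k : ℕ} → (Vec ℕ k → ℕ) → Set where
  fp-zero  : IsFP {0} (λ _ → 0)
  fp-s0    : IsFP {1} (λ { (x ∷ []) → 2 * x })
  fp-s1    : IsFP {1} (λ { (x ∷ []) → suc (2 * x) })
  fp-proj  : ∀ {k} (i : Fin k) → IsFP {k} (λ xs → lookup xs i)
  fp-smash : IsFP {2} (λ { (x ∷ y ∷ []) → 2 ^ (len x * len y) })
  fp-leq   : IsFP {2} leqF
  fp-comp  : ∀ {k m} {f : Vec ℕ m → ℕ} (gs : Fin m → Vec ℕ k → ℕ) →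
             IsFP f → (∀ j → IsFP (gs j)) →
             IsFP {k} (λ xs → f (Data.Vec.tabulate (λ j → gs j xs)))
  fp-lrn   : ∀ {k} {g : Vec ℕ k → ℕ} {h₀ h₁ : Vec ℕ (suc (suc k)) → ℕ}
             {b f : Vec ℕ (suc k) → ℕ} →
             IsFP g → IsFP h₀ → IsFP h₁ → IsFP b →
             (∀ xs → f (0 ∷ xs) ≡ g xs) →
             (∀ y xs → 0 < y → f (2 * y ∷ xs) ≡ h₀ (y ∷ f (y ∷ xs) ∷ xs)) →
             (∀ y xs → f (suc (2 * y) ∷ xs) ≡ h₁ (y ∷ f (y ∷ xs) ∷ xs)) →
             (∀ y xs → f (y ∷ xs) ≤ b (y ∷ xs)) →
             IsFP f

data Term (F : ℕ → Set) (n : ℕ) : Set where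
  var : Fin n → Term F n
  app : ∀ {k} → F k → Vec (Term F n) k → Term F n

infix  7 _≐_
infixr 6 _∧'_
infixr 5 _∨'_
infixr 4 _⇒'_
infix  8 ¬'_

data Form (F : ℕ → Set) (n : ℕ) : Set where
  _≐_  : Term F n → Term F n → Form F n
  ⊥'   : Form F n
  _∧'_ : Form F n → Form F n → Form F n
  _∨'_ : Form F n → Form F n → Form F n
  _⇒'_ : Form F n → Form F n → Form F n
  ¬'_  : Form F n → Form F n
  ∀'   : Form F (suc n) → Form F n
  ∃'   : Form F (suc n) → Form F n

Sentence : (ℕ → Set) → Set
Sentence F = Form F 0

module _ {F : ℕ → Set} where

  infix 2 _⊢_ _⊩_

  mutual
    renT : ∀ {n m} → (Fin n → Fin m) → Term F n → Term F m
    renT r (var x)    = var (r x)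
    renT r (app f ts) = app f (renTs r ts)

    renTs : ∀ {n m k} → (Fin n → Fin m) → Vec (Term F n) k → Vec (Term F m) k
    renTs r []       = []
    renTs r (t ∷ ts) = renT r t ∷ renTs r ts

  liftR : ∀ {n m} → (Fin n → Fin m) → Fin (suc n) → Fin (suc m)
  liftR r zero    = zero
  liftR r (suc x) = suc (r x)

  renF : ∀ {n m} → (Fin n → Fin m) → Form F n → Form F m
  renF r (s ≐ t)  = renT r s ≐ renT r t
  renF r ⊥'       = ⊥'
  renF r (φ ∧' ψ) = renF r φ ∧' renF r ψ
  renF r (φ ∨' ψ) = renF r φ ∨' renF r ψ
  renF r (φ ⇒' ψ) = renF r φ ⇒' renF r ψ
  renF r (¬' φ)   = ¬' renF r φ
  renF r (∀' φ)   = ∀' (renF (liftR r) φ)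
  renF r (∃' φ)   = ∃' (renF (liftR r) φ)

  wkT : ∀ {n} → Term F n → Term F (suc n)
  wkT = renT suc

  wkF : ∀ {n} → Form F n → Form F (suc n)
  wkF = renF suc

  mutual
    subT : ∀ {n m} → (Fin n → Term F m) → Term F n → Term F m
    subT σ (var x)    = σ x
    subT σ (app f ts) = app f (subTs σ ts)

    subTs : ∀ {n m k} → (Fin n → Term F m) → Vec (Term F n) k → Vec (Term F m) k
    subTs σ []       = []
    subTs σ (t ∷ ts) = subT σ t ∷ subTs σ ts

  liftS : ∀ {n m} → (Fin n → Term F m) → Fin (suc n) → Term F (suc m)
  liftS σ zero    = var zero
  liftS σ (suc x) = wkT (σ x)

  subF : ∀ {n m} → (Fin n → Term F m) → Form F n → Form F m
  subF σ (s ≐ t)  = subT σ s ≐ subT σ t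
  subF σ ⊥'       = ⊥'
  subF σ (φ ∧' ψ) = subF σ φ ∧' subF σ ψ
  subF σ (φ ∨' ψ) = subF σ φ ∨' subF σ ψ
  subF σ (φ ⇒' ψ) = subF σ φ ⇒' subF σ ψ
  subF σ (¬' φ)   = ¬' subF σ φ
  subF σ (∀' φ)   = ∀' (subF (liftS σ) φ)
  subF σ (∃' φ)   = ∃' (subF (liftS σ) φ)

  sub0 : ∀ {n} → Term F n → Fin (suc n) → Term F n
  sub0 t zero    = t
  sub0 t (suc x) = var x

  _[_] : ∀ {n} → Form F (suc n) → Term F n → Form F n
  φ [ t ] = subF (sub0 t) φ

  QF : ∀ {n} → Form F n → Set
  QF (s ≐ t)  = ⊤
  QF ⊥'       = ⊤
  QF (φ ∧' ψ) = QF φ × QF ψ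
  QF (φ ∨' ψ) = QF φ × QF ψ
  QF (φ ⇒' ψ) = QF φ × QF ψ
  QF (¬' φ)   = QF φ
  QF (∀' φ)   = ⊥
  QF (∃' φ)   = ⊥

  alls : ∀ k → Form F k → Form F 0
  alls zero    φ = φ
  alls (suc k) φ = alls k (∀' φ)

  data _⊢_ : ∀ {n} → List (Form F n) → Form F n → Set where
    hyp  : ∀ {n} {Γ : List (Form F n)} {φ} → φ ∈ Γ → Γ ⊢ φ
    ⊥E   : ∀ {n} {Γ : List (Form F n)} {φ} → Γ ⊢ ⊥' → Γ ⊢ φ
    raa  : ∀ {n} {Γ : List (Form F n)} {φ} → (¬' φ ∷ Γ) ⊢ ⊥' → Γ ⊢ φ
    ¬I   : ∀ {n} {Γ : List (Form F n)} {φ} → (φ ∷ Γ) ⊢ ⊥' → Γ ⊢ ¬' φ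
    ¬E   : ∀ {n} {Γ : List (Form F n)} {φ} → Γ ⊢ ¬' φ → Γ ⊢ φ → Γ ⊢ ⊥'
    ⇒I   : ∀ {n} {Γ : List (Form F n)} {φ ψ} → (φ ∷ Γ) ⊢ ψ → Γ ⊢ φ ⇒' ψ
    ⇒E   : ∀ {n} {Γ : List (Form F n)} {φ ψ} → Γ ⊢ φ ⇒' ψ → Γ ⊢ φ → Γ ⊢ ψ
    ∧I   : ∀ {n} {Γ : List (Form F n)} {φ ψ} → Γ ⊢ φ → Γ ⊢ ψ → Γ ⊢ φ ∧' ψ
    ∧E₁  : ∀ {n} {Γ : List (Form F n)} {φ ψ} → Γ ⊢ φ ∧' ψ → Γ ⊢ φ
    ∧E₂  : ∀ {n} {Γ : List (Form F n)} {φ ψ} → Γ ⊢ φ ∧' ψ → Γ ⊢ ψ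
    ∨I₁  : ∀ {n} {Γ : List (Form F n)} {φ ψ} → Γ ⊢ φ → Γ ⊢ φ ∨' ψ
    ∨I₂  : ∀ {n} {Γ : List (Form F n)} {φ ψ} → Γ ⊢ ψ → Γ ⊢ φ ∨' ψ
    ∨E   : ∀ {n} {Γ : List (Form F n)} {φ ψ χ} → Γ ⊢ φ ∨' ψ →
           (φ ∷ Γ) ⊢ χ → (ψ ∷ Γ) ⊢ χ → Γ ⊢ χ
    ∀I   : ∀ {n} {Γ : List (Form F n)} {φ} → map wkF Γ ⊢ φ → Γ ⊢ ∀' φ
    ∀E   : ∀ {n} {Γ : List (Form F n)} {φ} → Γ ⊢ ∀' φ → (t : Term F n) → Γ ⊢ φ [ t ]
    ∃I   : ∀ {n} {Γ : List (Form F n)} {φ} (t : Term F n) → Γ ⊢ φ [ t ] → Γ ⊢ ∃' φ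
    ∃E   : ∀ {n} {Γ : List (Form F n)} {φ ψ} → Γ ⊢ ∃' φ →
           (φ ∷ map wkF Γ) ⊢ wkF ψ → Γ ⊢ ψ
    ≐refl : ∀ {n} {Γ : List (Form F n)} (t : Term F n) → Γ ⊢ t ≐ t
    ≐subst : ∀ {n} {Γ : List (Form F n)} {s t : Term F n} (φ : Form F (suc n)) →
             Γ ⊢ s ≐ t → Γ ⊢ φ [ s ] → Γ ⊢ φ [ t ]

  _⊩_ : (Form F 0 → Set) → Form F 0 → Set
  T ⊩ φ = Σ (List (Form F 0)) λ Δ → All T Δ × (Δ ⊢ φ)

  Interp : Set
  Interp = ∀ {k} → F k → Vec ℕ k → ℕ

  module Sem (I : Interp) where
    mutual
      evalT : ∀ {n} → Vec ℕ n → Term F n → ℕ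
      evalT ρ (var x)    = lookup ρ x
      evalT ρ (app f ts) = I f (evalTs ρ ts)

      evalTs : ∀ {n k} → Vec ℕ n → Vec (Term F n) k → Vec ℕ k
      evalTs ρ []       = []
      evalTs ρ (t ∷ ts) = evalT ρ t ∷ evalTs ρ ts

    Sat : ∀ {n} → Vec ℕ n → Form F n → Set
    Sat ρ (s ≐ t)  = evalT ρ s ≡ evalT ρ t
    Sat ρ ⊥'       = ⊥
    Sat ρ (φ ∧' ψ) = Sat ρ φ × Sat ρ ψ
    Sat ρ (φ ∨' ψ) = Sat ρ φ ⊎ Sat ρ ψ
    Sat ρ (φ ⇒' ψ) = Sat ρ φ → Sat ρ ψ
    Sat ρ (¬' φ)   = ¬ Sat ρ φ
    Sat ρ (∀' φ)   = ∀ y → Sat (y ∷ ρ) φ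
    Sat ρ (∃' φ)   = Σ ℕ λ y → Sat (y ∷ ρ) φ

    True : Form F 0 → Set
    True φ = Sat [] φ

    mutual
      evalT-wk : ∀ {n} (ρ : Vec ℕ n) y (t : Term F n) → evalT (y ∷ ρ) (wkT t) ≡ evalT ρ t
      evalT-wk ρ y (var x)    = refl
      evalT-wk ρ y (app f ts) = cong (I f) (evalTs-wk ρ y ts)

      evalTs-wk : ∀ {n k} (ρ : Vec ℕ n) y (ts : Vec (Term F n) k) →
                  evalTs (y ∷ ρ) (renTs suc ts) ≡ evalTs ρ ts
      evalTs-wk ρ y []       = refl
      evalTs-wk ρ y (t ∷ ts) rewrite evalT-wk ρ y t | evalTs-wk ρ y ts = refl

    decQF : ∀ {n} (φ : Form F n) → QF φ → (ρ : Vec ℕ n) → Dec (Sat ρ φ)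
    decQF (s ≐ t)  q ρ = evalT ρ s Data.Nat.≟ evalT ρ t
    decQF ⊥'       q ρ = no (λ ())
    decQF (φ ∧' ψ) (p , q) ρ = decQF φ p ρ ×-dec decQF ψ q ρ
    decQF (φ ∨' ψ) (p , q) ρ = decQF φ p ρ ⊎-dec decQF ψ q ρ
    decQF (φ ⇒' ψ) (p , q) ρ = decQF φ p ρ →-dec decQF ψ q ρ
    decQF (¬' φ)   q ρ = ¬? (decQF φ q ρ)

data PVSym : ℕ → Set where
  zeroC : PVSym 0
  oneC  : PVSym 0
  fp    : ∀ {k} (f : Vec ℕ k → ℕ) → IsFP f → PVSym k

IPV : Interp {PVSym}
IPV zeroC    _  = 0
IPV oneC     _  = 1
IPV (fp f _) xs = f xs

open module SemPV = Sem {PVSym} IPV public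
  renaming (evalT to evalPV; Sat to SatPV; True to TruePV; evalT-wk to evalPV-wk)
  using ()

oneT : ∀ {n} → Term PVSym n
oneT = app oneC []

_≤'_ : ∀ {n} → Term PVSym n → Term PVSym n → Form PVSym n
s ≤' t = app (fp leqF fp-leq) (s ∷ t ∷ []) ≐ oneT

-- bounded quantifiers ∃x≤t φ, ∀x≤t φ (x = variable 0 of φ; t cannot contain x)
∃≤ : ∀ {n} → Term PVSym n → Form PVSym (suc n) → Form PVSym n
∃≤ t φ = ∃' ((var zero ≤' wkT t) ∧' φ)

∀≤ : ∀ {n} → Term PVSym n → Form PVSym (suc n) → Form PVSym n
∀≤ t φ = ∀' ((var zero ≤' wkT t) ⇒' φ)

mutual
  data Σb : ℕ → ∀ {n} → Form PVSym n → Set where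
    qfΣ  : ∀ {n} {φ : Form PVSym n} → QF φ → Σb 0 φ
    Σ↑Σ  : ∀ {i n} {φ : Form PVSym n} → Σb i φ → Σb (suc i) φ
    Π↑Σ  : ∀ {i n} {φ : Form PVSym n} → Πb i φ → Σb (suc i) φ
    ∧Σ   : ∀ {i n} {φ ψ : Form PVSym n} → Σb i φ → Σb i ψ → Σb i (φ ∧' ψ)
    ∨Σ   : ∀ {i n} {φ ψ : Form PVSym n} → Σb i φ → Σb i ψ → Σb i (φ ∨' ψ)
    ∃≤Σ  : ∀ {i n} (t : Term PVSym n) {φ : Form PVSym (suc n)} →
           Σb (suc i) φ → Σb (suc i) (∃≤ t φ)
    ¬Σ   : ∀ {i n} {φ : Form PVSym n} → Πb i φ → Σb i (¬' φ)

  data Πb : ℕ → ∀ {n} → Form PVSym n → Set where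
    qfΠ  : ∀ {n} {φ : Form PVSym n} → QF φ → Πb 0 φ
    Π↑Π  : ∀ {i n} {φ : Form PVSym n} → Πb i φ → Πb (suc i) φ
    Σ↑Π  : ∀ {i n} {φ : Form PVSym n} → Σb i φ → Πb (suc i) φ
    ∧Π   : ∀ {i n} {φ ψ : Form PVSym n} → Πb i φ → Πb i ψ → Πb i (φ ∧' ψ)
    ∨Π   : ∀ {i n} {φ ψ : Form PVSym n} → Πb i φ → Πb i ψ → Πb i (φ ∨' ψ)
    ∀≤Π  : ∀ {i n} (t : Term PVSym n) {φ : Form PVSym (suc n)} →
           Πb (suc i) φ → Πb (suc i) (∀≤ t φ)
    ¬Π   : ∀ {i n} {φ : Form PVSym n} → Σb i φ → Πb i (¬' φ)

leqF≡1 : ∀ x y → leqF (x ∷ y ∷ []) ≡ 1 → x ≤ y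
leqF≡1 x y e with x ≤? y
... | yes p = p
leqF≡1 x y () | no _

≤⇒leqF : ∀ x y → x ≤ y → leqF (x ∷ y ∷ []) ≡ 1
≤⇒leqF x y p with x ≤? y
... | yes _ = refl
... | no q  = Data.Empty.⊥-elim (q p)

module _ {P : ℕ → Set} (P? : ∀ y → Dec (P y)) where
  ∃≤? : ∀ b → Dec (Σ ℕ λ y → (y ≤ b) × P y)
  ∃≤? zero with P? 0
  ... | yes p = yes (0 , z≤n , p)
  ... | no ¬p = no λ { (zero , _ , p) → ¬p p ; (suc y , () , _) }
  ∃≤? (suc b) with P? (suc b) | ∃≤? b
  ... | yes p | _ = yes (suc b , NP.≤-refl , p)
  ... | no _  | yes (y , y≤b , p) = yes (y , NP.m≤n⇒m≤1+n y≤b , p)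
  ... | no ¬p | no ¬r = no λ { (y , y≤ , p) → case y≤ p }
    where
    case : ∀ {y} → y ≤ suc b → P y → ⊥
    case {y} y≤ p with NP.m≤n⇒m<n∨m≡n y≤
    ... | inj₁ (s≤s y≤b) = ¬r (y , y≤b , p)
    ... | inj₂ refl      = ¬p p

  ∀≤? : ∀ b → Dec (∀ y → y ≤ b → P y)
  ∀≤? zero with P? 0
  ... | yes p = yes λ { zero _ → p ; (suc y) () }
  ... | no ¬p = no λ h → ¬p (h 0 z≤n)
  ∀≤? (suc b) with P? (suc b) | ∀≤? b
  ... | no ¬p | _ = no λ h → ¬p (h (suc b) NP.≤-refl)
  ... | yes _ | no ¬r = no λ h → ¬r (λ y y≤ → h y (NP.m≤n⇒m≤1+n y≤))
  ... | yes p | yes r = yes λ y y≤ → case y y≤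
    where
    case : ∀ y → y ≤ suc b → P y
    case y y≤ with NP.m≤n⇒m<n∨m≡n y≤
    ... | inj₁ (s≤s y≤b) = r y y≤b
    ... | inj₂ refl      = p

mutual
  decΣ : ∀ {i n} {φ : Form PVSym n} → Σb i φ → (ρ : Vec ℕ n) → Dec (SatPV ρ φ)
  decΣ (qfΣ q) ρ = SemPV.decQF _ q ρ
  decΣ (Σ↑Σ p) ρ = decΣ p ρ
  decΣ (Π↑Σ p) ρ = decΠ p ρ
  decΣ (∧Σ p q) ρ = decΣ p ρ ×-dec decΣ q ρ
  decΣ (∨Σ p q) ρ = decΣ p ρ ⊎-dec decΣ q ρ
  decΣ (¬Σ p) ρ = ¬? (decΠ p ρ)
  decΣ (∃≤Σ t {φ} p) ρ with ∃≤? (λ y → decΣ p (y ∷ ρ)) (evalPV ρ t)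
  ... | yes (y , y≤ , s) =
        yes (y , (subst (λ b → leqF (y ∷ b ∷ []) ≡ 1) (sym (evalPV-wk ρ y t))
                   (≤⇒leqF y _ y≤)) , s)
  ... | no ¬e = no λ { (y , e , s) →
        ¬e (y , leqF≡1 y _ (subst (λ b → leqF (y ∷ b ∷ []) ≡ 1) (evalPV-wk ρ y t) e) , s) }

  decΠ : ∀ {i n} {φ : Form PVSym n} → Πb i φ → (ρ : Vec ℕ n) → Dec (SatPV ρ φ)
  decΠ (qfΠ q) ρ = SemPV.decQF _ q ρ
  decΠ (Π↑Π p) ρ = decΠ p ρ
  decΠ (Σ↑Π p) ρ = decΣ p ρ
  decΠ (∧Π p q) ρ = decΠ p ρ ×-dec decΠ q ρ
  decΠ (∨Π p q) ρ = decΠ p ρ ⊎-dec decΠ q ρ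
  decΠ (¬Π p) ρ = ¬? (decΣ p ρ)
  decΠ (∀≤Π t {φ} p) ρ with ∀≤? (λ y → decΠ p (y ∷ ρ)) (evalPV ρ t)
  ... | yes h = yes λ y e →
        h y (leqF≡1 y _ (subst (λ b → leqF (y ∷ b ∷ []) ≡ 1) (evalPV-wk ρ y t) e))
  ... | no ¬h = no λ h → ¬h λ y y≤ →
        h y (subst (λ b → leqF (y ∷ b ∷ []) ≡ 1) (sym (evalPV-wk ρ y t)) (≤⇒leqF y _ y≤))

decΣΠ : ∀ {i n} {φ : Form PVSym n} → Σb i φ ⊎ Πb i φ → (ρ : Vec ℕ n) → Dec (SatPV ρ φ)
decΣΠ (inj₁ p) = decΣ p
decΣΠ (inj₂ p) = decΠ p

charB : Bool → ℕ
charB true  = 1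
charB false = 0

leastUpTo : ℕ → (ℕ → Bool) → Maybe ℕ
leastUpTo zero    p = if p 0 then just 0 else nothing
leastUpTo (suc b) p = if p 0 then just 0 else Maybe.map suc (leastUpTo b (λ y → p (suc y)))

-- The language L^i_PV, written with i = suc j (so i ≥ 1 automatically).

data SymL (j : ℕ) : ℕ → Set where
  pv : ∀ {k} → PVSym k → SymL j k
  fα : ∀ {k} (α : Form PVSym k) → Σb j α ⊎ Πb j α → SymL j k
  -- g_{β,t} (only when i ≥ 2); β(x⃗,y) with y = variable 0, x⃗ = the others
  gβ : ∀ {k} → 1 ≤ j → (β : Form PVSym (suc k)) → Σb j β → (t : Term PVSym k) → SymL j k

IL : (j : ℕ) → Interp {SymL j}
IL j (pv s)          zs = IPV s zs
IL j (fα α p)        zs = charB (does (decΣΠ p zs))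
IL j (gβ _ β p t)    xs =
  fromMaybe 0 (leastUpTo (evalPV xs t) (λ y → does (decΣ p (y ∷ xs))))

module _ {F G : ℕ → Set} (τ : ∀ {k} → F k → G k) where
  mutual
    mapT : ∀ {n} → Term F n → Term G n
    mapT (var x)    = var x
    mapT (app f ts) = app (τ f) (mapTs ts)

    mapTs : ∀ {n k} → Vec (Term F n) k → Vec (Term G n) k
    mapTs []       = []
    mapTs (t ∷ ts) = mapT t ∷ mapTs ts

  mapF : ∀ {n} → Form F n → Form G n
  mapF (s ≐ t)  = mapT s ≐ mapT t
  mapF ⊥'       = ⊥'
  mapF (φ ∧' ψ) = mapF φ ∧' mapF ψ
  mapF (φ ∨' ψ) = mapF φ ∨' mapF ψ
  mapF (φ ⇒' ψ) = mapF φ ⇒' mapF ψ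
  mapF (¬' φ)   = ¬' mapF φ
  mapF (∀' φ)   = ∀' (mapF φ)
  mapF (∃' φ)   = ∃' (mapF φ)

embL : ∀ j {n} → Form PVSym n → Form (SymL j) n
embL j = mapF pv

T-PV : ℕ → Form PVSym 0 → Set
T-PV j ψ = Σ ℕ λ k → Σ (Form PVSym k) λ φ → Σb j φ × (ψ ≡ alls k φ) × TruePV ψ

U-PV : (j : ℕ) → Form (SymL j) 0 → Set
U-PV j ψ = Σ ℕ λ k → Σ (Form (SymL j) k) λ φ → QF φ × (ψ ≡ alls k φ) × Sem.True (IL j) ψ

module Submission where

-- A T^i_PV-derivation becomes an L^i_PV-derivation by reading every L_PV-symbol as itself,
-- so it suffices to derive each axiom ∀ȳ φ(ȳ), φ ∈ Σ^b_{i-1}, in U^i_PV.  The true universal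
-- sentence ∀ȳ f_φ(ȳ) = 1 is an axiom of U^i_PV, so everything reduces to
-- U^i_PV ⊢ ∀z̄ (f_α(z̄) = 1 ↔ α(z̄)), proved by induction on α ∈ Σ^b_{i-1} ∪ Π^b_{i-1}.
-- For a connective, the universal sentence relating f_α to the f's of its immediate
-- subformulas is true, hence an axiom.  For α = ∃y≤t β, g_{β,t} is a Skolem function: the true
-- universal sentences f_α(z̄) = 1 → g(z̄) ≤ t ∧ f_β(z̄, g(z̄)) = 1 and
-- y ≤ t ∧ f_β(z̄, y) = 1 → f_α(z̄) = 1 yield the equivalence.  For α = ∀y≤t β, dually,
-- g_{¬β,t} finds a counterexample whenever there is one.  Bounded quantifiers only occur from
-- level 1 on, which is exactly where the symbols g exist.

open import Data.Empty using (⊥-elim)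
open import Data.Fin using (Fin; zero; suc)
open import Data.List using (List; []; _∷_; map; _++_)
open import Data.List.Relation.Binary.Subset.Propositional using (_⊆_)
open import Data.List.Relation.Binary.Subset.Propositional.Properties
  using (∷⁺ʳ; map⁺; xs⊆xs++ys; xs⊆ys++xs)
open import Data.List.Membership.Propositional.Properties using (∈-map⁺)
open import Data.List.Relation.Unary.All as All using (All; []; _∷_)
import Data.List.Relation.Unary.All.Properties as AllP
open import Data.List.Relation.Unary.Any using (here; there)
open import Data.Bool using (Bool; true; false)
open import Data.Maybe using (just)
import Data.Maybe as Maybe
open import Data.Nat
  using (ℕ; zero; suc; _≤_; _≤′_; _<′_; ≤′-refl; ≤′-step; z≤n; s≤s)
open import Data.Nat.Properties using (≤′-trans; <′⇒<; m<n⇒0<n)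
open import Data.Product using (Σ; _×_; _,_)
open import Data.Product.Function.NonDependent.Propositional using (_×-⇔_)
open import Data.Sum using (_⊎_; inj₁; inj₂)
open import Data.Sum.Function.Propositional using (_⊎-⇔_)
open import Data.Unit using (tt)
open import Data.Vec using (Vec; []; _∷_; lookup; tabulate)
open import Data.Vec.Properties using (tabulate∘lookup)
open import Function using (_∘_)
open import Function.Bundles using (_⇔_; mk⇔; Equivalence)
import Function.Properties.Equivalence as ⇔
open import Function.Related.TypeIsomorphisms using (→-cong-⇔; ¬-cong-⇔)
open import Relation.Binary.PropositionalEquality
  using (_≡_; refl; sym; trans; cong; cong₂; subst; subst₂)
open import Relation.Nullary using (Dec; yes; no; does)
open import Relation.Nullary.Decidable using (dec-true; decidable-stable)

open import Defs

open Equivalence using (to; from)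

module _ {F : ℕ → Set} where

  private variable
    n m : ℕ
    Γ Δ : List (Form F n)
    X Y Z R : Form F n
    U : Form F 0 → Set

  mutual
    subT-renT-cancel : (σ : Fin m → Term F n) (r : Fin n → Fin m) →
                       (∀ x → σ (r x) ≡ var x) → ∀ t → subT σ (renT r t) ≡ t
    subT-renT-cancel σ r σ∘r (var x)    = σ∘r x
    subT-renT-cancel σ r σ∘r (app f ts) = cong (app f) (subTs-renTs-cancel σ r σ∘r ts)

    subTs-renTs-cancel : ∀ {k} (σ : Fin m → Term F n) (r : Fin n → Fin m) →
                         (∀ x → σ (r x) ≡ var x) → (ts : Vec (Term F n) k) →
                         subTs σ (renTs r ts) ≡ ts
    subTs-renTs-cancel σ r σ∘r []       = refl
    subTs-renTs-cancel σ r σ∘r (t ∷ ts) =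
      cong₂ _∷_ (subT-renT-cancel σ r σ∘r t) (subTs-renTs-cancel σ r σ∘r ts)

  liftS-liftR-cancel : (σ : Fin m → Term F n) (r : Fin n → Fin m) →
                       (∀ x → σ (r x) ≡ var x) → ∀ x → liftS σ (liftR {F = F} r x) ≡ var x
  liftS-liftR-cancel σ r σ∘r zero    = refl
  liftS-liftR-cancel σ r σ∘r (suc x) = cong wkT (σ∘r x)

  subF-renF-cancel : (σ : Fin m → Term F n) (r : Fin n → Fin m) →
                     (∀ x → σ (r x) ≡ var x) → ∀ φ → subF σ (renF r φ) ≡ φ
  subF-renF-cancel σ r σ∘r (s ≐ t)  =
    cong₂ _≐_ (subT-renT-cancel σ r σ∘r s) (subT-renT-cancel σ r σ∘r t)
  subF-renF-cancel σ r σ∘r ⊥'       = refl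
  subF-renF-cancel σ r σ∘r (φ ∧' ψ) =
    cong₂ _∧'_ (subF-renF-cancel σ r σ∘r φ) (subF-renF-cancel σ r σ∘r ψ)
  subF-renF-cancel σ r σ∘r (φ ∨' ψ) =
    cong₂ _∨'_ (subF-renF-cancel σ r σ∘r φ) (subF-renF-cancel σ r σ∘r ψ)
  subF-renF-cancel σ r σ∘r (φ ⇒' ψ) =
    cong₂ _⇒'_ (subF-renF-cancel σ r σ∘r φ) (subF-renF-cancel σ r σ∘r ψ)
  subF-renF-cancel σ r σ∘r (¬' φ)   = cong ¬'_ (subF-renF-cancel σ r σ∘r φ)
  subF-renF-cancel σ r σ∘r (∀' φ)   =
    cong ∀' (subF-renF-cancel (liftS σ) (liftR {F = F} r) (liftS-liftR-cancel σ r σ∘r) φ)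
  subF-renF-cancel σ r σ∘r (∃' φ)   =
    cong ∃' (subF-renF-cancel (liftS σ) (liftR {F = F} r) (liftS-liftR-cancel σ r σ∘r) φ)

  liftR-suc-[var0] : (X : Form F (suc n)) → renF (liftR {F = F} suc) X [ var zero ] ≡ X
  liftR-suc-[var0] =
    subF-renF-cancel (sub0 (var zero)) (liftR {F = F} suc) λ { zero → refl ; (suc x) → refl }

  ⊢-weaken : Γ ⊆ Δ → Γ ⊢ X → Δ ⊢ X
  ⊢-weaken Γ⊆Δ (hyp x)        = hyp (Γ⊆Δ x)
  ⊢-weaken Γ⊆Δ (⊥E d)         = ⊥E (⊢-weaken Γ⊆Δ d)
  ⊢-weaken Γ⊆Δ (raa d)        = raa (⊢-weaken (∷⁺ʳ _ Γ⊆Δ) d)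
  ⊢-weaken Γ⊆Δ (¬I d)         = ¬I (⊢-weaken (∷⁺ʳ _ Γ⊆Δ) d)
  ⊢-weaken Γ⊆Δ (¬E d e)       = ¬E (⊢-weaken Γ⊆Δ d) (⊢-weaken Γ⊆Δ e)
  ⊢-weaken Γ⊆Δ (⇒I d)         = ⇒I (⊢-weaken (∷⁺ʳ _ Γ⊆Δ) d)
  ⊢-weaken Γ⊆Δ (⇒E d e)       = ⇒E (⊢-weaken Γ⊆Δ d) (⊢-weaken Γ⊆Δ e)
  ⊢-weaken Γ⊆Δ (∧I d e)       = ∧I (⊢-weaken Γ⊆Δ d) (⊢-weaken Γ⊆Δ e)
  ⊢-weaken Γ⊆Δ (∧E₁ d)        = ∧E₁ (⊢-weaken Γ⊆Δ d)
  ⊢-weaken Γ⊆Δ (∧E₂ d)        = ∧E₂ (⊢-weaken Γ⊆Δ d)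
  ⊢-weaken Γ⊆Δ (∨I₁ d)        = ∨I₁ (⊢-weaken Γ⊆Δ d)
  ⊢-weaken Γ⊆Δ (∨I₂ d)        = ∨I₂ (⊢-weaken Γ⊆Δ d)
  ⊢-weaken Γ⊆Δ (∨E d e f)     =
    ∨E (⊢-weaken Γ⊆Δ d) (⊢-weaken (∷⁺ʳ _ Γ⊆Δ) e) (⊢-weaken (∷⁺ʳ _ Γ⊆Δ) f)
  ⊢-weaken Γ⊆Δ (∀I d)         = ∀I (⊢-weaken (map⁺ wkF Γ⊆Δ) d)
  ⊢-weaken Γ⊆Δ (∀E d t)       = ∀E (⊢-weaken Γ⊆Δ d) t
  ⊢-weaken Γ⊆Δ (∃I t d)       = ∃I t (⊢-weaken Γ⊆Δ d)
  ⊢-weaken Γ⊆Δ (∃E d e)       = ∃E (⊢-weaken Γ⊆Δ d) (⊢-weaken (∷⁺ʳ _ (map⁺ wkF Γ⊆Δ)) e)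
  ⊢-weaken Γ⊆Δ (≐refl t)      = ≐refl t
  ⊢-weaken Γ⊆Δ (≐subst φ d e) = ≐subst φ (⊢-weaken Γ⊆Δ d) (⊢-weaken Γ⊆Δ e)

  ∀E-wk : Γ ⊢ wkF (∀' X) → Γ ⊢ X
  ∀E-wk {X = X} d = subst (_ ⊢_) (liftR-suc-[var0] X) (∀E d (var zero))

  ∃I-wk : Γ ⊢ X → Γ ⊢ wkF (∃' X)
  ∃I-wk {X = X} d = ∃I (var zero) (subst (_ ⊢_) (sym (liftR-suc-[var0] X)) d)

  infix 4 _⇔'_
  _⇔'_ : Form F n → Form F n → Form F n
  X ⇔' Y = (X ⇒' Y) ∧' (Y ⇒' X)

  ⇔I : (X ∷ Γ) ⊢ Y → (Y ∷ Γ) ⊢ X → Γ ⊢ X ⇔' Y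
  ⇔I d e = ∧I (⇒I d) (⇒I e)

  ⇔E₁ : Γ ⊢ X ⇔' Y → Γ ⊢ X → Γ ⊢ Y
  ⇔E₁ d = ⇒E (∧E₁ d)

  ⇔E₂ : Γ ⊢ X ⇔' Y → Γ ⊢ Y → Γ ⊢ X
  ⇔E₂ d = ⇒E (∧E₂ d)

  hyp₀ : (X ∷ Γ) ⊢ X
  hyp₀ = hyp (here refl)

  hyp₁ : (Y ∷ X ∷ Γ) ⊢ X
  hyp₁ = hyp (there (here refl))

  hyp₂ : (Z ∷ Y ∷ X ∷ Γ) ⊢ X
  hyp₂ = hyp (there (there (here refl)))

  hyp₃ : (R ∷ Z ∷ Y ∷ X ∷ Γ) ⊢ X
  hyp₃ = hyp (there (there (there (here refl))))

  ⊢-alls : ∀ {n} {X : Form F n} → [] ⊢ X → [] ⊢ alls n X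
  ⊢-alls {n = zero}  d = d
  ⊢-alls {n = suc n} d = ⊢-alls {n = n} (∀I d)

  ⊩-mp : U ⊩ X ⇒' Y → U ⊩ X → U ⊩ Y
  ⊩-mp (Δ₁ , U-Δ₁ , d₁) (Δ₂ , U-Δ₂ , d₂) =
    Δ₁ ++ Δ₂ , AllP.++⁺ U-Δ₁ U-Δ₂ ,
    ⇒E (⊢-weaken (xs⊆xs++ys Δ₁ Δ₂) d₁) (⊢-weaken (xs⊆ys++xs Δ₂ Δ₁) d₂)

  ⊩-cut : {Γ : List (Form F 0)} → All (U ⊩_) Γ → Γ ⊢ X → U ⊩ X
  ⊩-cut []         d = [] , [] , d
  ⊩-cut (⊩ψ ∷ ⊩Γ) d = ⊩-mp (⊩-cut ⊩Γ (⇒I d)) ⊩ψ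

  -- A record rather than a synonym, so that n and X can be inferred.
  infix 2 _⊩∀_
  record _⊩∀_ {n} (U : Form F 0 → Set) (X : Form F n) : Set where
    constructor close
    field closed : U ⊩ alls n X

  ⊩∀-∀⁺ : U ⊩∀ X → U ⊩∀ ∀' X
  ⊩∀-∀⁺ (close ⊩X) = close ⊩X

  ⊩∀-∀⁻ : U ⊩∀ ∀' X → U ⊩∀ X
  ⊩∀-∀⁻ (close ⊩X) = close ⊩X

  ⊩∀-taut : [] ⊢ X → U ⊩∀ X
  ⊩∀-taut d = close ([] , [] , ⊢-alls d)

  ⊩∀-mp : ∀ {n} {X Y : Form F n} → U ⊩∀ X ⇒' Y → U ⊩∀ X → U ⊩∀ Y
  ⊩∀-mp {n = zero}          (close ⊩X⇒Y) (close ⊩X) = close (⊩-mp ⊩X⇒Y ⊩X)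
  ⊩∀-mp {n = suc n} {X} {Y} ⊩X⇒Y ⊩X =
    ⊩∀-∀⁻ (⊩∀-mp (⊩∀-mp (⊩∀-taut distrib) (⊩∀-∀⁺ ⊩X⇒Y)) (⊩∀-∀⁺ ⊩X))
    where
    distrib : [] ⊢ ∀' (X ⇒' Y) ⇒' ∀' X ⇒' ∀' Y
    distrib = ⇒I (⇒I (∀I (⇒E (∀E-wk hyp₁) (∀E-wk hyp₀))))

  ⊩∀-map : [] ⊢ X ⇒' Y → U ⊩∀ X → U ⊩∀ Y
  ⊩∀-map d = ⊩∀-mp (⊩∀-taut d)

  ⊩∀-map₂ : [] ⊢ X ⇒' Y ⇒' Z → U ⊩∀ X → U ⊩∀ Y → U ⊩∀ Z
  ⊩∀-map₂ d ⊩X = ⊩∀-mp (⊩∀-map d ⊩X)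

  ⊩∀-⇔E : U ⊩∀ X ⇔' Y → U ⊩∀ X → U ⊩∀ Y
  ⊩∀-⇔E = ⊩∀-mp ∘ ⊩∀-map (⇒I (∧E₁ hyp₀))

  ⊩∀-⇔-refl : U ⊩∀ X ⇔' X
  ⊩∀-⇔-refl = ⊩∀-taut (⇔I hyp₀ hyp₀)

  ⊩∀-⇔-trans : U ⊩∀ X ⇔' Y → U ⊩∀ Y ⇔' Z → U ⊩∀ X ⇔' Z
  ⊩∀-⇔-trans = ⊩∀-map₂ (⇒I (⇒I (⇔I (⇔E₁ hyp₁ (⇔E₁ hyp₂ hyp₀))
                                   (⇔E₂ hyp₂ (⇔E₂ hyp₁ hyp₀)))))

  ⊩∀-∧-cong : U ⊩∀ X ⇔' Y → U ⊩∀ Z ⇔' R → U ⊩∀ X ∧' Z ⇔' Y ∧' R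
  ⊩∀-∧-cong = ⊩∀-map₂ (⇒I (⇒I (⇔I (∧I (⇔E₁ hyp₂ (∧E₁ hyp₀)) (⇔E₁ hyp₁ (∧E₂ hyp₀)))
                                  (∧I (⇔E₂ hyp₂ (∧E₁ hyp₀)) (⇔E₂ hyp₁ (∧E₂ hyp₀))))))

  ⊩∀-∨-cong : U ⊩∀ X ⇔' Y → U ⊩∀ Z ⇔' R → U ⊩∀ X ∨' Z ⇔' Y ∨' R
  ⊩∀-∨-cong = ⊩∀-map₂ (⇒I (⇒I (⇔I (∨E hyp₀ (∨I₁ (⇔E₁ hyp₃ hyp₀)) (∨I₂ (⇔E₁ hyp₂ hyp₀)))
                                  (∨E hyp₀ (∨I₁ (⇔E₂ hyp₃ hyp₀)) (∨I₂ (⇔E₂ hyp₂ hyp₀))))))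

  ⊩∀-⇒-cong : U ⊩∀ X ⇔' Y → U ⊩∀ Z ⇔' R → U ⊩∀ (X ⇒' Z) ⇔' (Y ⇒' R)
  ⊩∀-⇒-cong = ⊩∀-map₂ (⇒I (⇒I (⇔I (⇒I (⇔E₁ hyp₂ (⇒E hyp₁ (⇔E₂ hyp₃ hyp₀))))
                                  (⇒I (⇔E₂ hyp₂ (⇒E hyp₁ (⇔E₁ hyp₃ hyp₀)))))))

  ⊩∀-¬-cong : U ⊩∀ X ⇔' Y → U ⊩∀ ¬' X ⇔' ¬' Y
  ⊩∀-¬-cong = ⊩∀-map (⇒I (⇔I (¬I (¬E hyp₁ (⇔E₂ hyp₂ hyp₀)))
                             (¬I (¬E hyp₁ (⇔E₁ hyp₂ hyp₀)))))

  ⊩∀-∀-cong : U ⊩∀ X ⇔' Y → U ⊩∀ ∀' X ⇔' ∀' Y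
  ⊩∀-∀-cong = ⊩∀-map (⇒I (⇔I (∀I (⇔E₁ (∀E-wk hyp₁) (∀E-wk hyp₀)))
                             (∀I (⇔E₂ (∀E-wk hyp₁) (∀E-wk hyp₀))))) ∘ ⊩∀-∀⁺

  ⊩∀-∃-cong : U ⊩∀ X ⇔' Y → U ⊩∀ ∃' X ⇔' ∃' Y
  ⊩∀-∃-cong = ⊩∀-map (⇒I (⇔I (∃E hyp₀ (∃I-wk (⇔E₁ (∀E-wk hyp₂) hyp₀)))
                             (∃E hyp₀ (∃I-wk (⇔E₂ (∀E-wk hyp₂) hyp₀))))) ∘ ⊩∀-∀⁺

  ⊩∀-skolem-∃ : (g : Term F n) {X : Form F (suc n)} →
                U ⊩∀ R ⇒' X [ g ] → U ⊩∀ X ⇒' wkF R → U ⊩∀ R ⇔' ∃' X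
  ⊩∀-skolem-∃ g ⊩R⇒X[g] ⊩X⇒R =
    ⊩∀-map₂ (⇒I (⇒I (⇔I (∃I g (⇒E hyp₂ hyp₀)) (∃E hyp₀ (⇒E (∀E-wk hyp₂) hyp₀)))))
            ⊩R⇒X[g] (⊩∀-∀⁺ ⊩X⇒R)

  ⊩∀-skolem-∀ : (g : Term F n) {X : Form F (suc n)} →
                U ⊩∀ wkF R ⇒' X → U ⊩∀ X [ g ] ⇒' R → U ⊩∀ R ⇔' ∀' X
  ⊩∀-skolem-∀ g ⊩R⇒X ⊩X[g]⇒R =
    ⊩∀-map₂ (⇒I (⇒I (⇔I (∀I (⇒E (∀E-wk hyp₂) hyp₀)) (⇒E hyp₁ (∀E hyp₀ g)))))
            (⊩∀-∀⁺ ⊩R⇒X) ⊩X[g]⇒R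

module _ {F G : ℕ → Set} (τ : ∀ {k} → F k → G k) where

  private variable
    n m : ℕ

  mutual
    mapT-renT : (r : Fin n → Fin m) (t : Term F n) → mapT τ (renT r t) ≡ renT r (mapT τ t)
    mapT-renT r (var x)    = refl
    mapT-renT r (app f ts) = cong (app (τ f)) (mapTs-renTs r ts)

    mapTs-renTs : ∀ {k} (r : Fin n → Fin m) (ts : Vec (Term F n) k) →
                  mapTs τ (renTs r ts) ≡ renTs r (mapTs τ ts)
    mapTs-renTs r []       = refl
    mapTs-renTs r (t ∷ ts) = cong₂ _∷_ (mapT-renT r t) (mapTs-renTs r ts)

  mapF-renF : (r : Fin n → Fin m) (φ : Form F n) → mapF τ (renF r φ) ≡ renF r (mapF τ φ)
  mapF-renF r (s ≐ t)  = cong₂ _≐_ (mapT-renT r s) (mapT-renT r t)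
  mapF-renF r ⊥'       = refl
  mapF-renF r (φ ∧' ψ) = cong₂ _∧'_ (mapF-renF r φ) (mapF-renF r ψ)
  mapF-renF r (φ ∨' ψ) = cong₂ _∨'_ (mapF-renF r φ) (mapF-renF r ψ)
  mapF-renF r (φ ⇒' ψ) = cong₂ _⇒'_ (mapF-renF r φ) (mapF-renF r ψ)
  mapF-renF r (¬' φ)   = cong ¬'_ (mapF-renF r φ)
  mapF-renF r (∀' φ)   = cong ∀' (mapF-renF (liftR {F = F} r) φ)
  mapF-renF r (∃' φ)   = cong ∃' (mapF-renF (liftR {F = F} r) φ)

  mutual
    mapT-subT : (σ : Fin n → Term F m) (σ' : Fin n → Term G m) →
                (∀ x → mapT τ (σ x) ≡ σ' x) →
                (t : Term F n) → mapT τ (subT σ t) ≡ subT σ' (mapT τ t)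
    mapT-subT σ σ' τσ≗σ' (var x)    = τσ≗σ' x
    mapT-subT σ σ' τσ≗σ' (app f ts) = cong (app (τ f)) (mapTs-subTs σ σ' τσ≗σ' ts)

    mapTs-subTs : ∀ {k} (σ : Fin n → Term F m) (σ' : Fin n → Term G m) →
                  (∀ x → mapT τ (σ x) ≡ σ' x) → (ts : Vec (Term F n) k) →
                  mapTs τ (subTs σ ts) ≡ subTs σ' (mapTs τ ts)
    mapTs-subTs σ σ' τσ≗σ' []       = refl
    mapTs-subTs σ σ' τσ≗σ' (t ∷ ts) =
      cong₂ _∷_ (mapT-subT σ σ' τσ≗σ' t) (mapTs-subTs σ σ' τσ≗σ' ts)

  mapT-liftS : (σ : Fin n → Term F m) (σ' : Fin n → Term G m) →
               (∀ x → mapT τ (σ x) ≡ σ' x) → ∀ x → mapT τ (liftS σ x) ≡ liftS σ' x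
  mapT-liftS σ σ' τσ≗σ' zero    = refl
  mapT-liftS σ σ' τσ≗σ' (suc x) = trans (mapT-renT suc (σ x)) (cong wkT (τσ≗σ' x))

  mapF-subF : (σ : Fin n → Term F m) (σ' : Fin n → Term G m) →
              (∀ x → mapT τ (σ x) ≡ σ' x) → (φ : Form F n) → mapF τ (subF σ φ) ≡ subF σ' (mapF τ φ)
  mapF-subF σ σ' τσ≗σ' (s ≐ t)  =
    cong₂ _≐_ (mapT-subT σ σ' τσ≗σ' s) (mapT-subT σ σ' τσ≗σ' t)
  mapF-subF σ σ' τσ≗σ' ⊥'       = refl
  mapF-subF σ σ' τσ≗σ' (φ ∧' ψ) =
    cong₂ _∧'_ (mapF-subF σ σ' τσ≗σ' φ) (mapF-subF σ σ' τσ≗σ' ψ)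
  mapF-subF σ σ' τσ≗σ' (φ ∨' ψ) =
    cong₂ _∨'_ (mapF-subF σ σ' τσ≗σ' φ) (mapF-subF σ σ' τσ≗σ' ψ)
  mapF-subF σ σ' τσ≗σ' (φ ⇒' ψ) =
    cong₂ _⇒'_ (mapF-subF σ σ' τσ≗σ' φ) (mapF-subF σ σ' τσ≗σ' ψ)
  mapF-subF σ σ' τσ≗σ' (¬' φ)   = cong ¬'_ (mapF-subF σ σ' τσ≗σ' φ)
  mapF-subF σ σ' τσ≗σ' (∀' φ)   =
    cong ∀' (mapF-subF (liftS σ) (liftS σ') (mapT-liftS σ σ' τσ≗σ') φ)
  mapF-subF σ σ' τσ≗σ' (∃' φ)   =
    cong ∃' (mapF-subF (liftS σ) (liftS σ') (mapT-liftS σ σ' τσ≗σ') φ)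

  mapF-[] : (φ : Form F (suc n)) (t : Term F n) → mapF τ (φ [ t ]) ≡ mapF τ φ [ mapT τ t ]
  mapF-[] φ t = mapF-subF (sub0 t) (sub0 (mapT τ t)) (λ { zero → refl ; (suc x) → refl }) φ

  map-mapF-wkF : (Γ : List (Form F n)) →
                 map (mapF τ) (map wkF Γ) ≡ map wkF (map (mapF τ) Γ)
  map-mapF-wkF []      = refl
  map-mapF-wkF (φ ∷ Γ) = cong₂ _∷_ (mapF-renF suc φ) (map-mapF-wkF Γ)

  ⊢-mapF : {Γ : List (Form F n)} {φ : Form F n} → Γ ⊢ φ → map (mapF τ) Γ ⊢ mapF τ φ
  ⊢-mapF (hyp φ∈Γ)  = hyp (∈-map⁺ (mapF τ) φ∈Γ)
  ⊢-mapF (⊥E d)     = ⊥E (⊢-mapF d)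
  ⊢-mapF (raa d)    = raa (⊢-mapF d)
  ⊢-mapF (¬I d)     = ¬I (⊢-mapF d)
  ⊢-mapF (¬E d e)   = ¬E (⊢-mapF d) (⊢-mapF e)
  ⊢-mapF (⇒I d)     = ⇒I (⊢-mapF d)
  ⊢-mapF (⇒E d e)   = ⇒E (⊢-mapF d) (⊢-mapF e)
  ⊢-mapF (∧I d e)   = ∧I (⊢-mapF d) (⊢-mapF e)
  ⊢-mapF (∧E₁ d)    = ∧E₁ (⊢-mapF d)
  ⊢-mapF (∧E₂ d)    = ∧E₂ (⊢-mapF d)
  ⊢-mapF (∨I₁ d)    = ∨I₁ (⊢-mapF d)
  ⊢-mapF (∨I₂ d)    = ∨I₂ (⊢-mapF d)
  ⊢-mapF (∨E d e f) = ∨E (⊢-mapF d) (⊢-mapF e) (⊢-mapF f)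
  ⊢-mapF {Γ = Γ} (∀I d) = ∀I (subst (_⊢ _) (map-mapF-wkF Γ) (⊢-mapF d))
  ⊢-mapF (∀E {φ = φ} d t) = subst (_ ⊢_) (sym (mapF-[] φ t)) (∀E (⊢-mapF d) (mapT τ t))
  ⊢-mapF (∃I {φ = φ} t d) = ∃I (mapT τ t) (subst (_ ⊢_) (mapF-[] φ t) (⊢-mapF d))
  ⊢-mapF {Γ = Γ} (∃E {ψ = ψ} d e) =
    ∃E (⊢-mapF d) (subst₂ (λ Δ χ → _ ∷ Δ ⊢ χ) (map-mapF-wkF Γ) (mapF-renF suc ψ) (⊢-mapF e))
  ⊢-mapF (≐refl t) = ≐refl (mapT τ t)
  ⊢-mapF (≐subst {s = s} {t = t} φ d e) =
    subst (_ ⊢_) (sym (mapF-[] φ t))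
      (≐subst (mapF τ φ) (⊢-mapF d) (subst (_ ⊢_) (mapF-[] φ s) (⊢-mapF e)))

  ⊩-mapF : {T : Form F 0 → Set} {U : Form G 0 → Set} {φ : Form F 0} →
           (∀ {ψ} → T ψ → U ⊩ mapF τ ψ) → T ⊩ φ → U ⊩ mapF τ φ
  ⊩-mapF U⊩T (Δ , T-Δ , d) = ⊩-cut (AllP.map⁺ (All.map U⊩T T-Δ)) (⊢-mapF d)

  mapF-alls : ∀ k (φ : Form F k) → mapF τ (alls k φ) ≡ alls k (mapF τ φ)
  mapF-alls zero    φ = refl
  mapF-alls (suc k) φ = mapF-alls k (∀' φ)

  QF-mapF : (φ : Form F n) → QF φ → QF (mapF τ φ)
  QF-mapF (s ≐ t)  _          = tt
  QF-mapF ⊥'       _          = tt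
  QF-mapF (φ ∧' ψ) (qφ , qψ) = QF-mapF φ qφ , QF-mapF ψ qψ
  QF-mapF (φ ∨' ψ) (qφ , qψ) = QF-mapF φ qφ , QF-mapF ψ qψ
  QF-mapF (φ ⇒' ψ) (qφ , qψ) = QF-mapF φ qφ , QF-mapF ψ qψ
  QF-mapF (¬' φ)   qφ         = QF-mapF φ qφ

Π-cong-⇔ : {I : Set} {A B : I → Set} → (∀ i → A i ⇔ B i) → (∀ i → A i) ⇔ (∀ i → B i)
Π-cong-⇔ A⇔B = mk⇔ (λ f i → to (A⇔B i) (f i)) (λ f i → from (A⇔B i) (f i))

Σ-cong-⇔ : {I : Set} {A B : I → Set} → (∀ i → A i ⇔ B i) → Σ I A ⇔ Σ I B
Σ-cong-⇔ A⇔B = mk⇔ (λ (i , a) → i , to (A⇔B i) a) (λ (i , b) → i , from (A⇔B i) b)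

module _ {F : ℕ → Set} (I : Interp {F}) where

  open Sem I

  private variable
    n m : ℕ

  evalTs-tabulate : ∀ {k} (ρ : Vec ℕ n) (f : Fin k → Term F n) →
                    evalTs ρ (tabulate f) ≡ tabulate (evalT ρ ∘ f)
  evalTs-tabulate {k = zero}  ρ f = refl
  evalTs-tabulate {k = suc k} ρ f = cong (evalT ρ (f zero) ∷_) (evalTs-tabulate ρ (f ∘ suc))

  evalTs-vars : (ρ : Vec ℕ n) → evalTs ρ (tabulate var) ≡ ρ
  evalTs-vars ρ = trans (evalTs-tabulate ρ var) (tabulate∘lookup ρ)

  mutual
    evalT-subT : (σ : Fin n → Term F m) {ρ : Vec ℕ m} {ρ' : Vec ℕ n} →
                 (∀ x → evalT ρ (σ x) ≡ lookup ρ' x) → ∀ t → evalT ρ (subT σ t) ≡ evalT ρ' t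
    evalT-subT σ σ↦ρ' (var x)    = σ↦ρ' x
    evalT-subT σ σ↦ρ' (app f ts) = cong (I f) (evalTs-subTs σ σ↦ρ' ts)

    evalTs-subTs : ∀ {k} (σ : Fin n → Term F m) {ρ : Vec ℕ m} {ρ' : Vec ℕ n} →
                   (∀ x → evalT ρ (σ x) ≡ lookup ρ' x) → (ts : Vec (Term F n) k) →
                   evalTs ρ (subTs σ ts) ≡ evalTs ρ' ts
    evalTs-subTs σ σ↦ρ' []       = refl
    evalTs-subTs σ σ↦ρ' (t ∷ ts) = cong₂ _∷_ (evalT-subT σ σ↦ρ' t) (evalTs-subTs σ σ↦ρ' ts)

  evalT-liftS : (σ : Fin n → Term F m) {ρ : Vec ℕ m} {ρ' : Vec ℕ n} →
                (∀ x → evalT ρ (σ x) ≡ lookup ρ' x) →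
                ∀ y x → evalT (y ∷ ρ) (liftS σ x) ≡ lookup (y ∷ ρ') x
  evalT-liftS σ     σ↦ρ' y zero    = refl
  evalT-liftS σ {ρ} σ↦ρ' y (suc x) = trans (evalT-wk ρ y (σ x)) (σ↦ρ' x)

  Sat-subF : (σ : Fin n → Term F m) {ρ : Vec ℕ m} {ρ' : Vec ℕ n} →
             (∀ x → evalT ρ (σ x) ≡ lookup ρ' x) → ∀ φ → Sat ρ (subF σ φ) ⇔ Sat ρ' φ
  Sat-subF σ σ↦ρ' (s ≐ t) rewrite evalT-subT σ σ↦ρ' s | evalT-subT σ σ↦ρ' t = ⇔.refl
  Sat-subF σ σ↦ρ' ⊥'       = ⇔.refl
  Sat-subF σ σ↦ρ' (φ ∧' ψ) = Sat-subF σ σ↦ρ' φ ×-⇔ Sat-subF σ σ↦ρ' ψ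
  Sat-subF σ σ↦ρ' (φ ∨' ψ) = Sat-subF σ σ↦ρ' φ ⊎-⇔ Sat-subF σ σ↦ρ' ψ
  Sat-subF σ σ↦ρ' (φ ⇒' ψ) = →-cong-⇔ (Sat-subF σ σ↦ρ' φ) (Sat-subF σ σ↦ρ' ψ)
  Sat-subF σ σ↦ρ' (¬' φ)   = ¬-cong-⇔ (Sat-subF σ σ↦ρ' φ)
  Sat-subF σ σ↦ρ' (∀' φ)   = Π-cong-⇔ λ y → Sat-subF (liftS σ) (evalT-liftS σ σ↦ρ' y) φ
  Sat-subF σ σ↦ρ' (∃' φ)   = Σ-cong-⇔ λ y → Sat-subF (liftS σ) (evalT-liftS σ σ↦ρ' y) φ

  Sat-[] : (ρ : Vec ℕ n) (t : Term F n) (φ : Form F (suc n)) →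
           Sat ρ (φ [ t ]) ⇔ Sat (evalT ρ t ∷ ρ) φ
  Sat-[] ρ t = Sat-subF (sub0 t) λ { zero → refl ; (suc x) → refl }

  Sat-wkF-≐ : (ρ : Vec ℕ n) (y : ℕ) (s t : Term F n) →
              Sat (y ∷ ρ) (wkF (s ≐ t)) ⇔ Sat ρ (s ≐ t)
  Sat-wkF-≐ ρ y s t rewrite evalT-wk ρ y s | evalT-wk ρ y t = ⇔.refl

  Sat-⇔' : {ρ : Vec ℕ n} {X Y : Form F n} → Sat ρ X ⇔ Sat ρ Y → Sat ρ (X ⇔' Y)
  Sat-⇔' X⇔Y = to X⇔Y , from X⇔Y

  True-alls⁺ : ∀ k {φ : Form F k} → (∀ ρ → Sat ρ φ) → True (alls k φ)
  True-alls⁺ zero    ⊨φ = ⊨φ []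
  True-alls⁺ (suc k) ⊨φ = True-alls⁺ k λ ρ y → ⊨φ (y ∷ ρ)

  True-alls⁻ : ∀ k {φ : Form F k} → True (alls k φ) → ∀ ρ → Sat ρ φ
  True-alls⁻ zero    ⊨φ []      = ⊨φ
  True-alls⁻ (suc k) ⊨φ (y ∷ ρ) = True-alls⁻ k ⊨φ ρ y

module _ {F G : ℕ → Set} (τ : ∀ {k} → F k → G k) (I : Interp {F}) (J : Interp {G})
         (τ-preserves : ∀ {k} (f : F k) xs → J (τ f) xs ≡ I f xs) where

  private
    module I = Sem I
    module J = Sem J

  mutual
    evalT-mapT : ∀ {n} (ρ : Vec ℕ n) (t : Term F n) → J.evalT ρ (mapT τ t) ≡ I.evalT ρ t
    evalT-mapT ρ (var x)    = refl
    evalT-mapT ρ (app f ts) = trans (cong (J (τ f)) (evalTs-mapTs ρ ts)) (τ-preserves f _)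

    evalTs-mapTs : ∀ {n k} (ρ : Vec ℕ n) (ts : Vec (Term F n) k) →
                   J.evalTs ρ (mapTs τ ts) ≡ I.evalTs ρ ts
    evalTs-mapTs ρ []       = refl
    evalTs-mapTs ρ (t ∷ ts) = cong₂ _∷_ (evalT-mapT ρ t) (evalTs-mapTs ρ ts)

  Sat-mapF : ∀ {n} (ρ : Vec ℕ n) (φ : Form F n) → J.Sat ρ (mapF τ φ) ⇔ I.Sat ρ φ
  Sat-mapF ρ (s ≐ t) rewrite evalT-mapT ρ s | evalT-mapT ρ t = ⇔.refl
  Sat-mapF ρ ⊥'       = ⇔.refl
  Sat-mapF ρ (φ ∧' ψ) = Sat-mapF ρ φ ×-⇔ Sat-mapF ρ ψ
  Sat-mapF ρ (φ ∨' ψ) = Sat-mapF ρ φ ⊎-⇔ Sat-mapF ρ ψ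
  Sat-mapF ρ (φ ⇒' ψ) = →-cong-⇔ (Sat-mapF ρ φ) (Sat-mapF ρ ψ)
  Sat-mapF ρ (¬' φ)   = ¬-cong-⇔ (Sat-mapF ρ φ)
  Sat-mapF ρ (∀' φ)   = Π-cong-⇔ λ y → Sat-mapF (y ∷ ρ) φ
  Sat-mapF ρ (∃' φ)   = Σ-cong-⇔ λ y → Sat-mapF (y ∷ ρ) φ

charB-does : {P : Set} (P? : Dec P) → charB (does P?) ≡ 1 ⇔ P
charB-does (yes p) = mk⇔ (λ _ → p) (λ _ → refl)
charB-does (no ¬p) = mk⇔ (λ ()) (⊥-elim ∘ ¬p)

does-true : {P : Set} (P? : Dec P) → does P? ≡ true → P
does-true (yes p) _ = p

leastUpTo-witness : ∀ b (p : ℕ → Bool) {y} → y ≤ b → p y ≡ true →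
                    Σ ℕ λ v → leastUpTo b p ≡ just v × v ≤ b × p v ≡ true
leastUpTo-witness zero    p z≤n py rewrite py = 0 , refl , z≤n , py
leastUpTo-witness (suc b) p {y} y≤ py with p 0 in p0
... | true = 0 , refl , z≤n , p0
leastUpTo-witness (suc b) p {zero} y≤ py | false with () ← trans (sym py) p0
leastUpTo-witness (suc b) p {suc y} (s≤s y≤b) py | false
  with v , found , v≤b , p-v ← leastUpTo-witness b (p ∘ suc) y≤b py
  = suc v , cong (Maybe.map suc) found , s≤s v≤b , p-v

<′⇒≤′ : ∀ {m n} → m <′ n → m ≤′ n
<′⇒≤′ = ≤′-trans (≤′-step ≤′-refl)

Σb-mono : ∀ {i j n} {φ : Form PVSym n} → i ≤′ j → Σb i φ → Σb j φ
Σb-mono ≤′-refl        dφ = dφ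
Σb-mono (≤′-step i≤j) dφ = Σ↑Σ (Σb-mono i≤j dφ)

Πb-mono : ∀ {i j n} {φ : Form PVSym n} → i ≤′ j → Πb i φ → Πb j φ
Πb-mono ≤′-refl        dφ = dφ
Πb-mono (≤′-step i≤j) dφ = Π↑Π (Πb-mono i≤j dφ)

module _ (j : ℕ) where

  open Sem (IL j) using (evalT; Sat)

  private variable
    n : ℕ

  ΣΠb : Form PVSym n → Set
  ΣΠb φ = Σb j φ ⊎ Πb j φ

  vars : Vec (Term (SymL j) n) n
  vars = tabulate var

  fα-holds : (φ : Form PVSym n) → ΣΠb φ → Form (SymL j) n
  fα-holds φ c = app (fα φ c) vars ≐ app (pv oneC) []

  FαSpec : (φ : Form PVSym n) → ΣΠb φ → Set
  FαSpec φ c = U-PV j ⊩∀ fα-holds φ c ⇔' embL j φ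

  gβ-term : 1 ≤ j → (β : Form PVSym (suc n)) → Σb j β → Term PVSym n → Term (SymL j) n
  gβ-term 1≤j β dβ t = app (gβ 1≤j β dβ t) vars

  Sat-fα-holds : (φ : Form PVSym n) (c : ΣΠb φ) (ρ : Vec ℕ n) →
                 Sat ρ (fα-holds φ c) ⇔ SatPV ρ φ
  Sat-fα-holds φ c ρ rewrite evalTs-vars (IL j) ρ = charB-does (decΣΠ c ρ)

  Sat-wkF-fα-holds : (φ : Form PVSym n) (c : ΣΠb φ) (ρ : Vec ℕ n) (y : ℕ) →
                     Sat (y ∷ ρ) (wkF (fα-holds φ c)) ⇔ SatPV ρ φ
  Sat-wkF-fα-holds φ c ρ y =
    ⇔.trans (Sat-wkF-≐ (IL j) ρ y (app (fα φ c) vars) (app (pv oneC) [])) (Sat-fα-holds φ c ρ)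

  Sat-embL : (ρ : Vec ℕ n) (φ : Form PVSym n) → Sat ρ (embL j φ) ⇔ SatPV ρ φ
  Sat-embL = Sat-mapF pv IPV (IL j) λ _ _ → refl

  SatPV-≤' : (ρ : Vec ℕ n) (y : ℕ) (t : Term PVSym n) →
             SatPV (y ∷ ρ) (var zero ≤' wkT t) ⇔ y ≤ evalPV ρ t
  SatPV-≤' ρ y t rewrite evalPV-wk ρ y t = mk⇔ (leqF≡1 y _) (≤⇒leqF y _)

  Sat-≤' : (ρ : Vec ℕ n) (y : ℕ) (t : Term PVSym n) →
           Sat (y ∷ ρ) (embL j (var zero ≤' wkT t)) ⇔ y ≤ evalPV ρ t
  Sat-≤' ρ y t = ⇔.trans (Sat-embL (y ∷ ρ) (var zero ≤' wkT t)) (SatPV-≤' ρ y t)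

  evalT-gβ : (1≤j : 1 ≤ j) (β : Form PVSym (suc n)) (dβ : Σb j β) (t : Term PVSym n)
             (ρ : Vec ℕ n) {y : ℕ} → y ≤ evalPV ρ t → SatPV (y ∷ ρ) β →
             let g = evalT ρ (gβ-term 1≤j β dβ t) in g ≤ evalPV ρ t × SatPV (g ∷ ρ) β
  evalT-gβ 1≤j β dβ t ρ y≤t βy rewrite evalTs-vars (IL j) ρ
    with v , found , v≤t , β-v ← leastUpTo-witness (evalPV ρ t) (λ z → does (decΣ dβ (z ∷ ρ)))
                                                    y≤t (dec-true (decΣ dβ _) βy)
    rewrite found = v≤t , does-true (decΣ dβ _) β-v

  ⊩∀-true : {X : Form (SymL j) n} → QF X → (∀ ρ → Sat ρ X) → U-PV j ⊩∀ X
  ⊩∀-true {n} {X} qX ⊨X =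
    close (alls n X ∷ [] , (n , X , qX , refl , True-alls⁺ (IL j) n ⊨X) ∷ [] , hyp (here refl))

  fα-axiom : (φ : Form PVSym n) (c : ΣΠb φ) (H : Form (SymL j) n) → QF H →
             (∀ ρ → Sat ρ H ⇔ SatPV ρ φ) → U-PV j ⊩∀ fα-holds φ c ⇔' H
  fα-axiom φ c H qH H⇔φ = ⊩∀-true ((tt , qH) , (qH , tt)) λ ρ →
    Sat-⇔' (IL j) {X = fα-holds φ c} (⇔.trans (Sat-fα-holds φ c ρ) (⇔.sym (H⇔φ ρ)))

  FαSpec-qf : {φ : Form PVSym n} → QF φ → (c : ΣΠb φ) → FαSpec φ c
  FαSpec-qf {φ = φ} qφ c = fα-axiom φ c (embL j φ) (QF-mapF pv φ qφ) λ ρ → Sat-embL ρ φ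

  FαSpec-∧ : {A B : Form PVSym n} {cA : ΣΠb A} {cB : ΣΠb B} (c : ΣΠb (A ∧' B)) →
             FαSpec A cA → FαSpec B cB → FαSpec (A ∧' B) c
  FαSpec-∧ {A = A} {B} {cA} {cB} c ⊩A ⊩B =
    ⊩∀-⇔-trans (fα-axiom (A ∧' B) c (fα-holds A cA ∧' fα-holds B cB) (tt , tt)
                  λ ρ → Sat-fα-holds A cA ρ ×-⇔ Sat-fα-holds B cB ρ)
               (⊩∀-∧-cong ⊩A ⊩B)

  FαSpec-∨ : {A B : Form PVSym n} {cA : ΣΠb A} {cB : ΣΠb B} (c : ΣΠb (A ∨' B)) →
             FαSpec A cA → FαSpec B cB → FαSpec (A ∨' B) c
  FαSpec-∨ {A = A} {B} {cA} {cB} c ⊩A ⊩B =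
    ⊩∀-⇔-trans (fα-axiom (A ∨' B) c (fα-holds A cA ∨' fα-holds B cB) (tt , tt)
                  λ ρ → Sat-fα-holds A cA ρ ⊎-⇔ Sat-fα-holds B cB ρ)
               (⊩∀-∨-cong ⊩A ⊩B)

  FαSpec-¬ : {A : Form PVSym n} {cA : ΣΠb A} (c : ΣΠb (¬' A)) → FαSpec A cA → FαSpec (¬' A) c
  FαSpec-¬ {A = A} {cA} c ⊩A =
    ⊩∀-⇔-trans (fα-axiom (¬' A) c (¬' fα-holds A cA) tt λ ρ → ¬-cong-⇔ (Sat-fα-holds A cA ρ))
               (⊩∀-¬-cong ⊩A)

  FαSpec-∃≤ : ∀ {n} (t : Term PVSym n) {ψ : Form PVSym (suc n)} (1≤j : 1 ≤ j) (dψ : Σb j ψ)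
              (c : ΣΠb (∃≤ t ψ)) → FαSpec ψ (inj₁ dψ) → FαSpec (∃≤ t ψ) c
  FαSpec-∃≤ {n} t {ψ} 1≤j dψ c ⊩ψ =
    ⊩∀-⇔-trans (⊩∀-skolem-∃ g (⊩∀-true (tt , tt , tt) witness) (⊩∀-true ((tt , tt) , tt) ∃-intro))
               (⊩∀-∃-cong (⊩∀-∧-cong ⊩∀-⇔-refl ⊩ψ))
    where
    g : Term (SymL j) n
    g = gβ-term 1≤j ψ dψ t

    bound : Form PVSym (suc n)
    bound = var zero ≤' wkT t

    body : Form (SymL j) (suc n)
    body = embL j bound ∧' fα-holds ψ (inj₁ dψ)

    witness : ∀ ρ → Sat ρ (fα-holds (∃≤ t ψ) c ⇒' body [ g ])
    witness ρ ∃≤tψ with y , y≤t , ψy ← to (Sat-fα-holds (∃≤ t ψ) c ρ) ∃≤tψ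
      with g≤t , ψg ← evalT-gβ 1≤j ψ dψ t ρ (to (SatPV-≤' ρ y t) y≤t) ψy
      = from (Sat-[] (IL j) ρ g body)
             (from (Sat-≤' ρ _ t) g≤t , from (Sat-fα-holds ψ (inj₁ dψ) _) ψg)

    ∃-intro : ∀ ρ → Sat ρ (body ⇒' wkF (fα-holds (∃≤ t ψ) c))
    ∃-intro (y ∷ ρ) (y≤t , ψy) =
      from (Sat-wkF-fα-holds (∃≤ t ψ) c ρ y)
        (y , to (Sat-embL (y ∷ ρ) bound) y≤t , to (Sat-fα-holds ψ (inj₁ dψ) (y ∷ ρ)) ψy)

  FαSpec-∀≤ : ∀ {n} (t : Term PVSym n) {ψ : Form PVSym (suc n)} (1≤j : 1 ≤ j) (dψ : Πb j ψ)
              (c : ΣΠb (∀≤ t ψ)) → FαSpec ψ (inj₂ dψ) → FαSpec (∀≤ t ψ) c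
  FαSpec-∀≤ {n} t {ψ} 1≤j dψ c ⊩ψ =
    ⊩∀-⇔-trans (⊩∀-skolem-∀ g (⊩∀-true (tt , tt , tt) ∀-elim)
                              (⊩∀-true ((tt , tt) , tt) counterexample))
               (⊩∀-∀-cong (⊩∀-⇒-cong ⊩∀-⇔-refl ⊩ψ))
    where
    g : Term (SymL j) n
    g = gβ-term 1≤j (¬' ψ) (¬Σ dψ) t

    bound : Form PVSym (suc n)
    bound = var zero ≤' wkT t

    body : Form (SymL j) (suc n)
    body = embL j bound ⇒' fα-holds ψ (inj₂ dψ)

    ∀-elim : ∀ ρ → Sat ρ (wkF (fα-holds (∀≤ t ψ) c) ⇒' body)
    ∀-elim (y ∷ ρ) ∀≤tψ y≤t =
      from (Sat-fα-holds ψ (inj₂ dψ) (y ∷ ρ))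
        (to (Sat-wkF-fα-holds (∀≤ t ψ) c ρ y) ∀≤tψ y (to (Sat-embL (y ∷ ρ) bound) y≤t))

    -- A bounded y with ¬ ψ y would make g a bounded counterexample, contradicting body [ g ].
    counterexample : ∀ ρ → Sat ρ (body [ g ] ⇒' fα-holds (∀≤ t ψ) c)
    counterexample ρ body[g] = from (Sat-fα-holds (∀≤ t ψ) c ρ) λ y y≤t →
      decidable-stable (decΠ dψ (y ∷ ρ)) λ ¬ψy →
        let g≤t , ¬ψg = evalT-gβ 1≤j (¬' ψ) (¬Σ dψ) t ρ (to (SatPV-≤' ρ y t) y≤t) ¬ψy
        in ¬ψg (to (Sat-fα-holds ψ (inj₂ dψ) _)
                   (to (Sat-[] (IL j) ρ g body) body[g] (from (Sat-≤' ρ _ t) g≤t)))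

  -- Subformulas lie at levels i ≤ j, but the symbols are always those of L^{j+1}_PV; and as
  -- f_φ is indexed by a classification c of φ, the claim is made for every c.
  mutual
    Σb⇒FαSpec : ∀ {i} {φ : Form PVSym n} → Σb i φ → i ≤′ j → (c : ΣΠb φ) → FαSpec φ c
    Σb⇒FαSpec (qfΣ qφ)   _   c = FαSpec-qf qφ c
    Σb⇒FαSpec (Σ↑Σ dφ)   i<j c = Σb⇒FαSpec dφ (<′⇒≤′ i<j) c
    Σb⇒FαSpec (Π↑Σ dφ)   i<j c = Πb⇒FαSpec dφ (<′⇒≤′ i<j) c
    Σb⇒FαSpec (∧Σ dA dB) i≤j c = FαSpec-∧ c (Σb⇒FαSpec dA i≤j (inj₁ (Σb-mono i≤j dA)))
                                            (Σb⇒FαSpec dB i≤j (inj₁ (Σb-mono i≤j dB)))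
    Σb⇒FαSpec (∨Σ dA dB) i≤j c = FαSpec-∨ c (Σb⇒FαSpec dA i≤j (inj₁ (Σb-mono i≤j dA)))
                                            (Σb⇒FαSpec dB i≤j (inj₁ (Σb-mono i≤j dB)))
    Σb⇒FαSpec (¬Σ dA)    i≤j c = FαSpec-¬ c (Πb⇒FαSpec dA i≤j (inj₂ (Πb-mono i≤j dA)))
    Σb⇒FαSpec (∃≤Σ t dψ) i<j c = FαSpec-∃≤ t (m<n⇒0<n (<′⇒< i<j)) (Σb-mono i<j dψ) c
                                             (Σb⇒FαSpec dψ i<j (inj₁ (Σb-mono i<j dψ)))

    Πb⇒FαSpec : ∀ {i} {φ : Form PVSym n} → Πb i φ → i ≤′ j → (c : ΣΠb φ) → FαSpec φ c
    Πb⇒FαSpec (qfΠ qφ)   _   c = FαSpec-qf qφ c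
    Πb⇒FαSpec (Π↑Π dφ)   i<j c = Πb⇒FαSpec dφ (<′⇒≤′ i<j) c
    Πb⇒FαSpec (Σ↑Π dφ)   i<j c = Σb⇒FαSpec dφ (<′⇒≤′ i<j) c
    Πb⇒FαSpec (∧Π dA dB) i≤j c = FαSpec-∧ c (Πb⇒FαSpec dA i≤j (inj₂ (Πb-mono i≤j dA)))
                                            (Πb⇒FαSpec dB i≤j (inj₂ (Πb-mono i≤j dB)))
    Πb⇒FαSpec (∨Π dA dB) i≤j c = FαSpec-∨ c (Πb⇒FαSpec dA i≤j (inj₂ (Πb-mono i≤j dA)))
                                            (Πb⇒FαSpec dB i≤j (inj₂ (Πb-mono i≤j dB)))
    Πb⇒FαSpec (¬Π dA)    i≤j c = FαSpec-¬ c (Σb⇒FαSpec dA i≤j (inj₁ (Σb-mono i≤j dA)))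
    Πb⇒FαSpec (∀≤Π t dψ) i<j c = FαSpec-∀≤ t (m<n⇒0<n (<′⇒< i<j)) (Πb-mono i<j dψ) c
                                             (Πb⇒FαSpec dψ i<j (inj₂ (Πb-mono i<j dψ)))

  U-PV⊩T-PV-axiom : {ψ : Form PVSym 0} → T-PV j ψ → U-PV j ⊩ embL j ψ
  U-PV⊩T-PV-axiom (k , φ , dφ , refl , ⊨ψ) =
    subst (U-PV j ⊩_) (sym (mapF-alls pv k φ)) (_⊩∀_.closed (⊩∀-⇔E (Σb⇒FαSpec dφ ≤′-refl c) ⊩fα))
    where
    c : ΣΠb φ
    c = inj₁ dφ

    ⊩fα : U-PV j ⊩∀ fα-holds φ c
    ⊩fα = ⊩∀-true tt λ ρ → from (Sat-fα-holds φ c ρ) (True-alls⁻ IPV k ⊨ψ ρ)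

theorem2p14 : (j : ℕ) (φ : Form PVSym 0) → T-PV j ⊩ φ → U-PV j ⊩ embL j φ
theorem2p14 j φ = ⊩-mapF pv (U-PV⊩T-PV-axiom j)
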